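{- For all integers $m \geq 0$ and all $x \notin \{\pm 1, \pm i, 1 \pm \sqrt{2}\}$, \[ a_m(x) = \alpha_+(x) \beta_+(x)^m + \alpha_-(x) \beta_-(x)^m, \] where \[ \alpha_\pm(x) = \pm \frac{x^4-2x^3-1}{2 \sqrt{(x^4-1)(x^2-2x-1)}} + \frac{1-x}2, \qquad \beta_\pm(x) = \frac{ -x^3+x^2-x-1 \pm \sqrt{(x^4-1)(x^2-2x-1)}}{2}. \]
   Context: For an integer $m\ge 0$, the transfer graph $G_m$ is the directed graph whose vertices are the pairs $(i,j)$ with $i,j\in\{0,\dots,m\}$ and $j\in\{i-1,i,i+1\}$, with an edge $(i,j)\to(j,k)$ for all such vertices unless $j=i\pm1$ and $k=i$ (loops allowed). $A_m$ is its adjacency matrix and $a_m(x)=\det(A_m-xI)$. In the formula, the same (fixed) value of the square root $\sqrt{(x^4-1)(x^2-2x-1)}$ is used in both $\alpha_\pm$ and $\beta_\pm$. -}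

module Defs where

open import Level using (Level; _⊔_) renaming (suc to lsuc)
open import Data.Nat using (ℕ; zero; suc; _≡ᵇ_)
open import Data.Bool using (Bool; true; false; _∨_; _∧_; if_then_else_)
open import Data.Product using (_×_; _,_; Σ)
open import Data.List using (List; length; lookup; concatMap; filter; upTo; map; filterᵇ)
open import Data.Fin using (Fin; zero; suc; punchIn; toℕ)
open import Relation.Nullary using (¬_)
open import Algebra.Bundles using (CommutativeRing)

record Field (c ℓ : Level) : Set (lsuc (c ⊔ ℓ)) where
  field
    commutativeRing : CommutativeRing c ℓ
  open CommutativeRing commutativeRing public
  field
    0≉1     : ¬ (0# ≈ 1#)
    inverse : ∀ x → ¬ (x ≈ 0#) → Σ Carrier (λ y → x * y ≈ 1#)

module RingOps {c ℓ} (R : CommutativeRing c ℓ) where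
  open CommutativeRing R using (Carrier; _+_; _*_; -_; 0#; 1#)

  pow : Carrier → ℕ → Carrier
  pow x zero    = 1#
  pow x (suc n) = x * pow x n

  alt : ℕ → Carrier → Carrier
  alt zero    a = a
  alt (suc n) a = - alt n a

  sumFin : (n : ℕ) → (Fin n → Carrier) → Carrier
  sumFin zero    f = 0#
  sumFin (suc n) f = f zero + sumFin n (λ i → f (suc i))

  det : (n : ℕ) → (Fin n → Fin n → Carrier) → Carrier
  det zero    M = 1#
  det (suc n) M =
    sumFin (suc n) (λ j → alt (toℕ j)
      (M zero j * det n (λ i k → M (suc i) (punchIn j k))))

  fromBool : Bool → Carrier
  fromBool true  = 1#
  fromBool false = 0#

-- Vertices of the transfer graph G_m: pairs (i , j) with i , j ∈ {0,…,m}
-- and j ∈ {i-1, i, i+1}, listed in lexicographic order.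
near : ℕ → ℕ → Bool
near i j = (j ≡ᵇ i) ∨ (suc j ≡ᵇ i) ∨ (j ≡ᵇ suc i)

vertices : ℕ → List (ℕ × ℕ)
vertices m = concatMap (λ i → map (λ j → (i , j)) (filterᵇ (near i) (upTo (suc m)))) (upTo (suc m))

nV : ℕ → ℕ
nV m = length (vertices m)

vertex : (m : ℕ) → Fin (nV m) → ℕ × ℕ
vertex m = lookup (vertices m)

edge : ℕ × ℕ → ℕ × ℕ → Bool
edge (i , j) (j' , k) =
  (j' ≡ᵇ j) ∧ Data.Bool.not (((j ≡ᵇ suc i) ∨ (suc j ≡ᵇ i)) ∧ (k ≡ᵇ i))

module Transfer {c ℓ} (R : CommutativeRing c ℓ) where
  open CommutativeRing R using (Carrier; _-_; _*_)
  open RingOps R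

  A : (m : ℕ) → Fin (nV m) → Fin (nV m) → Carrier
  A m p q = fromBool (edge (vertex m p) (vertex m q))

  I : (m : ℕ) → Fin (nV m) → Fin (nV m) → Carrier
  I m p q = fromBool (toℕ p ≡ᵇ toℕ q)

  a : ℕ → Carrier → Carrier
  a m x = det (nV m) (λ p q → A m p q - x * I m p q)

{-# OPTIONS --safe #-}
module Submission where

open import Defs
open import Algebra.Bundles using (CommutativeRing)
import Algebra.Solver.Ring
import Algebra.Solver.Ring.AlmostCommutativeRing as ACR
open import Data.Nat as ℕ using (ℕ; zero; suc; _≡ᵇ_; _<_; _≤_; _<?_; s≤s)
import Data.Nat.Properties as ℕₚ
open import Data.Integer as ℤ using (ℤ; +_; -[1+_]; _⊖_)
import Data.Integer.Properties as ℤₚ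
open import Data.Sign as Sign using (Sign)
open import Data.Bool using (Bool; true; false; _∨_)
open import Data.Maybe using (Maybe; just; nothing)
open import Data.Product as Product using (_×_; _,_; proj₁)
open import Data.Sum using (_⊎_; inj₁; inj₂)
open import Data.List as List using (List; []; _∷_; _++_; [_]; concat; concatMap; filterᵇ; upTo; applyUpTo)
import Data.List.Properties as Listₚ
open import Data.Fin as Fin using (Fin; toℕ; punchIn; _↑ˡ_; _↑ʳ_)
import Data.Fin.Properties as Finₚ
open import Data.Vec as Vec using (Vec; []; _∷_; lookup; removeAt; iterate)
import Data.Vec.Properties as Vecₚ
open import Data.Vec.Relation.Unary.Any as Any using (Any; here; there; any?)
import Data.Vec.Relation.Unary.Any.Properties as Anyₚ
open import Data.Vec.Membership.Propositional using (_∈_; find)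
open import Data.Vec.Membership.Propositional.Properties using (∈-++⁺ˡ)
open import Function using (_∘_)
open import Relation.Nullary using (¬_; Dec; yes; no)
open import Relation.Binary.PropositionalEquality as ≡ using (_≡_)

-- Ordering the vertices of G_m lexicographically, A_m − xI becomes the leading
-- (3m+1) × (3m+1) block of one infinite band matrix, invariant under shifting
-- rows and columns by 3. Expanding three rows of its minor σ (rows and columns
-- from 3 on), and of two companions π and κ, expresses them linearly in the same
-- three minors one block further down. Hence (σ, π − κ) evolves by the transfer
-- matrix [[x² − x³, 1], [−x², −1 − x]], of trace −x³ + x² − x − 1 and determinant
-- x⁴, so a_{m+2} = (−x³ + x² − x − 1) a_{m+1} − x⁴ a_m. The closed form satisfies
-- the same recurrence because β₊ + β₋ and β₊ β₋ are that trace and determinant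
-- (by s² = (x⁴ − 1)(x² − 2x − 1) and 2h = 1), and it agrees with a_m for m = 0, 1.

module IntegerCoefficients {c ℓ} (R : CommutativeRing c ℓ) where

  open CommutativeRing R
  open RingOps R using (pow)
  open import Algebra.Properties.Ring ring
    using (-‿involutive; -‿distribˡ-*; -‿distribʳ-*; -‿+-comm; -0#≈0#)
  open import Algebra.Properties.Semiring.Mult.TCOptimised semiring
    using (1+×; ×-homo-+; ×1-homo-*) renaming (_×_ to _×′_)
  open import Relation.Binary.Reasoning.Setoid setoid

  signed : Sign → Carrier → Carrier
  signed Sign.+ y = y
  signed Sign.- y = - y

  fromℤ : ℤ → Carrier
  fromℤ (+ n)    = n ×′ 1#
  fromℤ -[1+ n ] = - (suc n ×′ 1#)

  private
    +-cancelˡ-difference : ∀ u a b → (u + a) - (u + b) ≈ a - b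
    +-cancelˡ-difference u a b = begin
      (u + a) + - (u + b)      ≈⟨ +-congˡ (sym (-‿+-comm u b)) ⟩
      (u + a) + (- u + - b)    ≈⟨ +-congʳ (+-comm u a) ⟩
      (a + u) + (- u + - b)    ≈⟨ +-assoc a u _ ⟩
      a + (u + (- u + - b))    ≈⟨ +-congˡ (sym (+-assoc u (- u) (- b))) ⟩
      a + ((u - u) + - b)      ≈⟨ +-congˡ (+-congʳ (-‿inverseʳ u)) ⟩
      a + (0# + - b)           ≈⟨ +-congˡ (+-identityˡ (- b)) ⟩
      a - b                    ∎

  fromℤ-⊖ : ∀ m n → fromℤ (m ⊖ n) ≈ m ×′ 1# - n ×′ 1#
  fromℤ-⊖ m       zero    = sym (trans (+-congˡ -0#≈0#) (+-identityʳ _))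
  fromℤ-⊖ zero    (suc n) = sym (+-identityˡ _)
  fromℤ-⊖ (suc m) (suc n) = begin
    fromℤ (suc m ⊖ suc n)             ≡⟨ ≡.cong fromℤ (ℤₚ.[1+m]⊖[1+n]≡m⊖n m n) ⟩
    fromℤ (m ⊖ n)                     ≈⟨ fromℤ-⊖ m n ⟩
    m ×′ 1# - n ×′ 1#                 ≈⟨ sym (+-cancelˡ-difference 1# _ _) ⟩
    (1# + m ×′ 1#) - (1# + n ×′ 1#)   ≈⟨ sym (+-cong (1+× m 1#) (-‿cong (1+× n 1#))) ⟩
    suc m ×′ 1# - suc n ×′ 1#         ∎

  fromℤ-+ : ∀ i j → fromℤ (i ℤ.+ j) ≈ fromℤ i + fromℤ j
  fromℤ-+ (+ m)    (+ n)    = ×-homo-+ 1# m n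
  fromℤ-+ (+ m)    -[1+ n ] = fromℤ-⊖ m (suc n)
  fromℤ-+ -[1+ m ] (+ n)    = trans (fromℤ-⊖ n (suc m)) (+-comm _ _)
  fromℤ-+ -[1+ m ] -[1+ n ] = begin
    - (suc (suc (m ℕ.+ n)) ×′ 1#)       ≡⟨ ≡.cong (λ k → - (suc k ×′ 1#)) (≡.sym (ℕₚ.+-suc m n)) ⟩
    - ((suc m ℕ.+ suc n) ×′ 1#)         ≈⟨ -‿cong (×-homo-+ 1# (suc m) (suc n)) ⟩
    - (suc m ×′ 1# + suc n ×′ 1#)       ≈⟨ sym (-‿+-comm _ _) ⟩
    - (suc m ×′ 1#) + - (suc n ×′ 1#)   ∎

  fromℤ-signAbs : ∀ i → fromℤ i ≈ signed (ℤ.sign i) (ℤ.∣ i ∣ ×′ 1#)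
  fromℤ-signAbs (+ zero)  = refl
  fromℤ-signAbs (+ suc n) = refl
  fromℤ-signAbs -[1+ n ]  = refl

  fromℤ-◃ : ∀ s n → fromℤ (s ℤ.◃ n) ≈ signed s (n ×′ 1#)
  fromℤ-◃ Sign.- zero    = sym -0#≈0#
  fromℤ-◃ Sign.+ zero    = refl
  fromℤ-◃ Sign.- (suc n) = refl
  fromℤ-◃ Sign.+ (suc n) = refl

  signed-cong : ∀ s {a b} → a ≈ b → signed s a ≈ signed s b
  signed-cong Sign.+ a≈b = a≈b
  signed-cong Sign.- a≈b = -‿cong a≈b

  signed-* : ∀ s t a b → signed (s Sign.* t) (a * b) ≈ signed s a * signed t b
  signed-* Sign.+ Sign.+ a b = refl
  signed-* Sign.+ Sign.- a b = -‿distribʳ-* a b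
  signed-* Sign.- Sign.+ a b = -‿distribˡ-* a b
  signed-* Sign.- Sign.- a b = begin
    a * b          ≈⟨ sym (-‿involutive _) ⟩
    - - (a * b)    ≈⟨ -‿cong (-‿distribˡ-* a b) ⟩
    - (- a * b)    ≈⟨ -‿distribʳ-* (- a) b ⟩
    - a * - b      ∎

  fromℤ-* : ∀ i j → fromℤ (i ℤ.* j) ≈ fromℤ i * fromℤ j
  fromℤ-* i j = begin
    fromℤ (s ℤ.◃ ∣i∣ ℕ.* ∣j∣)          ≈⟨ fromℤ-◃ s (∣i∣ ℕ.* ∣j∣) ⟩
    signed s ((∣i∣ ℕ.* ∣j∣) ×′ 1#)     ≈⟨ signed-cong s (×1-homo-* ∣i∣ ∣j∣) ⟩
    signed s (∣i∣ ×′ 1# * ∣j∣ ×′ 1#)   ≈⟨ signed-* (ℤ.sign i) (ℤ.sign j) _ _ ⟩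
    signed (ℤ.sign i) (∣i∣ ×′ 1#) * signed (ℤ.sign j) (∣j∣ ×′ 1#)
                                       ≈⟨ sym (*-cong (fromℤ-signAbs i) (fromℤ-signAbs j)) ⟩
    fromℤ i * fromℤ j                  ∎
    where
    s = ℤ.sign i Sign.* ℤ.sign j
    ∣i∣ = ℤ.∣ i ∣
    ∣j∣ = ℤ.∣ j ∣

  fromℤ-neg : ∀ i → fromℤ (ℤ.- i) ≈ - fromℤ i
  fromℤ-neg (+ zero)  = sym -0#≈0#
  fromℤ-neg (+ suc n) = refl
  fromℤ-neg -[1+ n ]  = sym (-‿involutive _)

  fromℤ-homomorphism : ℤ.+-*-rawRing ACR.-Raw-AlmostCommutative⟶ ACR.fromCommutativeRing R
  fromℤ-homomorphism = record
    { ⟦_⟧    = fromℤ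
    ; +-homo = fromℤ-+
    ; *-homo = fromℤ-*
    ; -‿homo = fromℤ-neg
    ; 0-homo = refl
    ; 1-homo = refl
    }

  private
    fromℤ-≟ : ∀ i j → Maybe (fromℤ i ≈ fromℤ j)
    fromℤ-≟ i j with i ℤ.≟ j
    ... | yes ≡.refl = just refl
    ... | no _       = nothing

  open Algebra.Solver.Ring ℤ.+-*-rawRing (ACR.fromCommutativeRing R) fromℤ-homomorphism fromℤ-≟ public

  powₚ : ∀ {n} → Polynomial n → ℕ → Polynomial n
  powₚ p zero    = con (+ 1)
  powₚ p (suc k) = p :* powₚ p k

  twoₚ : ∀ {n} → Polynomial n
  twoₚ = con (+ 1) :+ con (+ 1)

removeAt-punchIn : ∀ {A : Set} {n} (v : Vec A (suc n)) i j →
                   lookup (removeAt v i) j ≡ lookup v (punchIn i j)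
removeAt-punchIn (a ∷ v)     Fin.zero    j           = ≡.refl
removeAt-punchIn (a ∷ b ∷ v) (Fin.suc i) Fin.zero    = ≡.refl
removeAt-punchIn (a ∷ b ∷ v) (Fin.suc i) (Fin.suc j) = removeAt-punchIn (b ∷ v) i j

removeAt-++ˡ : ∀ {A : Set} {w t} (v : Vec A (suc w)) (u : Vec A t) i →
               removeAt (v Vec.++ u) (i ↑ˡ t) ≡ removeAt v i Vec.++ u
removeAt-++ˡ (a ∷ v)     u Fin.zero    = ≡.refl
removeAt-++ˡ (a ∷ b ∷ v) u (Fin.suc i) = ≡.cong (a ∷_) (removeAt-++ˡ (b ∷ v) u i)

removeAt-map : ∀ {A B : Set} {n} (f : A → B) (v : Vec A (suc n)) i →
               removeAt (Vec.map f v) i ≡ Vec.map f (removeAt v i)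
removeAt-map f (a ∷ v)     Fin.zero    = ≡.refl
removeAt-map f (a ∷ b ∷ v) (Fin.suc i) = ≡.cong (f a ∷_) (removeAt-map f (b ∷ v) i)

∈-removeAt : ∀ {A : Set} {n} {a : A} {v : Vec A (suc n)} → a ∈ v → ∀ i →
             lookup v i ≡ a ⊎ a ∈ removeAt v i
∈-removeAt (here a≡b)                  Fin.zero    = inj₁ (≡.sym a≡b)
∈-removeAt (there a∈v)                 Fin.zero    = inj₂ a∈v
∈-removeAt {v = _ ∷ _ ∷ _} (here a≡b)  (Fin.suc i) = inj₂ (here a≡b)
∈-removeAt {v = _ ∷ _ ∷ _} (there a∈v) (Fin.suc i) with ∈-removeAt a∈v i
... | inj₁ eq     = inj₁ eq
... | inj₂ a∈rest = inj₂ (there a∈rest)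

lookup-iterate-suc : ∀ b t (j : Fin t) → lookup (iterate suc b t) j ≡ b ℕ.+ toℕ j
lookup-iterate-suc b (suc t) Fin.zero    = ≡.sym (ℕₚ.+-identityʳ b)
lookup-iterate-suc b (suc t) (Fin.suc j) =
  ≡.trans (lookup-iterate-suc (suc b) t j) (≡.sym (ℕₚ.+-suc b (toℕ j)))

map-iterate-suc : ∀ p b t → Vec.map (p ℕ.+_) (iterate suc b t) ≡ iterate suc (p ℕ.+ b) t
map-iterate-suc p b zero    = ≡.refl
map-iterate-suc p b (suc t) = ≡.cong (p ℕ.+ b ∷_)
  (≡.trans (map-iterate-suc p (suc b) t) (≡.cong (λ b′ → iterate suc b′ t) (ℕₚ.+-suc p b)))

module Minors {c ℓ} (R : CommutativeRing c ℓ) where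

  open CommutativeRing R
  open RingOps R
  open import Algebra.Properties.Ring ring using (-0#≈0#; -‿distribˡ-*)
  open import Relation.Binary.Reasoning.Setoid setoid

  sumFin-cong : ∀ n {f g : Fin n → Carrier} → (∀ i → f i ≈ g i) → sumFin n f ≈ sumFin n g
  sumFin-cong zero    f≈g = refl
  sumFin-cong (suc n) f≈g = +-cong (f≈g Fin.zero) (sumFin-cong n (f≈g ∘ Fin.suc))

  sumFin-cong≡ : ∀ n {f g : Fin n → Carrier} → (∀ i → f i ≡ g i) → sumFin n f ≡ sumFin n g
  sumFin-cong≡ zero    f≡g = ≡.refl
  sumFin-cong≡ (suc n) f≡g = ≡.cong₂ _+_ (f≡g Fin.zero) (sumFin-cong≡ n (f≡g ∘ Fin.suc))

  sumFin-zero : ∀ n {f : Fin n → Carrier} → (∀ i → f i ≈ 0#) → sumFin n f ≈ 0#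
  sumFin-zero zero    f≈0 = refl
  sumFin-zero (suc n) f≈0 =
    trans (+-cong (f≈0 Fin.zero) (sumFin-zero n (f≈0 ∘ Fin.suc))) (+-identityˡ 0#)

  sumFin-++ : ∀ m n (f : Fin (m ℕ.+ n) → Carrier) →
              sumFin (m ℕ.+ n) f ≈ sumFin m (λ i → f (i ↑ˡ n)) + sumFin n (λ i → f (m ↑ʳ i))
  sumFin-++ zero    n f = sym (+-identityˡ _)
  sumFin-++ (suc m) n f = trans (+-congˡ (sumFin-++ m n (f ∘ Fin.suc))) (sym (+-assoc _ _ _))

  alt-cong : ∀ j {a b} → a ≈ b → alt j a ≈ alt j b
  alt-cong zero    a≈b = a≈b
  alt-cong (suc j) a≈b = -‿cong (alt-cong j a≈b)

  alt-zero : ∀ j {a} → a ≈ 0# → alt j a ≈ 0#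
  alt-zero zero    a≈0 = a≈0
  alt-zero (suc j) a≈0 = trans (-‿cong (alt-zero j a≈0)) -0#≈0#

  alt-*ˡ : ∀ j a b → alt j (a * b) ≈ alt j a * b
  alt-*ˡ zero    a b = refl
  alt-*ˡ (suc j) a b = trans (-‿cong (alt-*ˡ j a b)) (-‿distribˡ-* _ b)

  det-cong : ∀ n {M N : Fin n → Fin n → Carrier} → (∀ i k → M i k ≈ N i k) → det n M ≈ det n N
  det-cong zero    M≈N = refl
  det-cong (suc n) M≈N = sumFin-cong (suc n) λ j → alt-cong (toℕ j)
    (*-cong (M≈N Fin.zero j) (det-cong n (λ i k → M≈N (Fin.suc i) (punchIn j k))))

  module _ (M : ℕ → ℕ → Carrier) where

    -- Opaque, so that minors are compared through their arguments instead of
    -- being unfolded into their (huge) Laplace expansions.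
    opaque
      minor : ∀ {n} → ℕ → Vec ℕ n → Carrier
      minor {zero}  r cs = 1#
      minor {suc n} r cs = sumFin (suc n) λ j →
        alt (toℕ j) (M r (lookup cs j) * minor (suc r) (removeAt cs j))

    opaque
      unfolding minor

      minor-[] : ∀ r → minor r [] ≡ 1#
      minor-[] r = ≡.refl

      det≈minor : ∀ {n} r (cs : Vec ℕ n) →
                  det n (λ i k → M (r ℕ.+ toℕ i) (lookup cs k)) ≈ minor r cs
      det≈minor {zero}  r cs = refl
      det≈minor {suc n} r cs = sumFin-cong (suc n) λ j → alt-cong (toℕ j) (*-cong
        (reflexive (≡.cong (λ r′ → M r′ (lookup cs j)) (ℕₚ.+-identityʳ r)))
        (trans (det-cong n (λ i k → reflexive
                  (≡.cong₂ M (ℕₚ.+-suc r (toℕ i)) (≡.sym (removeAt-punchIn cs j k)))))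
               (det≈minor (suc r) (removeAt cs j))))

      minor-window : ∀ {w t} r (W : Vec ℕ (suc w)) (T : Vec ℕ t) → (∀ j → M r (lookup T j) ≈ 0#) →
        minor r (W Vec.++ T) ≈ sumFin (suc w) λ j →
          alt (toℕ j) (M r (lookup W j) * minor (suc r) (removeAt W j Vec.++ T))
      minor-window {w} {t} r W T T≈0 = begin
        minor r (W Vec.++ T)
          ≈⟨ sumFin-++ (suc w) t term ⟩
        sumFin (suc w) (λ j → term (j ↑ˡ t)) + sumFin t (λ j → term (suc w ↑ʳ j))
          ≈⟨ +-cong (sumFin-cong (suc w) window-term) (sumFin-zero t tail-term) ⟩
        _ + 0#
          ≈⟨ +-identityʳ _ ⟩
        _ ∎
        where
        term : Fin (suc w ℕ.+ t) → Carrier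
        term j = alt (toℕ j) (M r (lookup (W Vec.++ T) j) * minor (suc r) (removeAt (W Vec.++ T) j))
        window-term : ∀ j →
          term (j ↑ˡ t) ≈ alt (toℕ j) (M r (lookup W j) * minor (suc r) (removeAt W j Vec.++ T))
        window-term j = reflexive (≡.trans
          (≡.cong₂ (λ k c → alt k (M r c * minor (suc r) (removeAt (W Vec.++ T) (j ↑ˡ t))))
                   (Finₚ.toℕ-↑ˡ j t) (Vecₚ.lookup-++ˡ W T j))
          (≡.cong (λ cs → alt (toℕ j) (M r (lookup W j) * minor (suc r) cs)) (removeAt-++ˡ W T j)))
        tail-term : ∀ j → term (suc w ↑ʳ j) ≈ 0#
        tail-term j = alt-zero (toℕ (suc w ↑ʳ j))
          (trans (*-congʳ (trans (reflexive (≡.cong (M r) (Vecₚ.lookup-++ʳ W T j))) (T≈0 j))) (zeroˡ _))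

      minor-zeroColumn : ∀ {n} r (cs : Vec ℕ n) {c} → c ∈ cs →
                         (∀ {r′} → r ≤ r′ → M r′ c ≈ 0#) → minor r cs ≈ 0#
      minor-zeroColumn {suc n} r cs c∈cs column≈0 =
        sumFin-zero (suc n) λ j → alt-zero (toℕ j) (term≈0 j)
        where
        term≈0 : ∀ j → M r (lookup cs j) * minor (suc r) (removeAt cs j) ≈ 0#
        term≈0 j with ∈-removeAt c∈cs j
        ... | inj₁ ≡.refl = trans (*-congʳ (column≈0 ℕₚ.≤-refl)) (zeroˡ _)
        ... | inj₂ c∈rest = trans (*-congˡ (minor-zeroColumn (suc r) (removeAt cs j) c∈rest
                                     (λ r<r′ → column≈0 (ℕₚ.<⇒≤ r<r′)))) (zeroʳ _)

      minor-shift : ∀ p → (∀ r c → M (p ℕ.+ r) (p ℕ.+ c) ≡ M r c) →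
                    ∀ {n} r (cs : Vec ℕ n) → minor (p ℕ.+ r) (Vec.map (p ℕ.+_) cs) ≡ minor r cs
      minor-shift p periodic {zero}  r cs = ≡.refl
      minor-shift p periodic {suc n} r cs =
        sumFin-cong≡ (suc n) λ j → ≡.cong₂ (λ a b → alt (toℕ j) (a * b))
        (≡.trans (≡.cong (M (p ℕ.+ r)) (Vecₚ.lookup-map j (p ℕ.+_) cs)) (periodic r (lookup cs j)))
        (≡.trans (≡.cong₂ minor (≡.sym (ℕₚ.+-suc p r)) (removeAt-map (p ℕ.+_) cs j))
                 (minor-shift p periodic (suc r) (removeAt cs j)))

module LinearRecurrences {c ℓ} (R : CommutativeRing c ℓ) where

  open CommutativeRing R
  open RingOps R
  open IntegerCoefficients R
  open import Relation.Binary.Reasoning.Setoid setoid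

  Satisfies : Carrier → Carrier → (ℕ → Carrier) → Set ℓ
  Satisfies p q u = ∀ m → u (suc (suc m)) ≈ p * u (suc m) - q * u m

  Satisfies-cong : ∀ {p p′ q q′ u} → p ≈ p′ → q ≈ q′ → Satisfies p q u → Satisfies p′ q′ u
  Satisfies-cong p≈p′ q≈q′ rec m = trans (rec m) (+-cong (*-congʳ p≈p′) (-‿cong (*-congʳ q≈q′)))

  Satisfies-unique : ∀ {p q u v} → Satisfies p q u → Satisfies p q v →
                     u 0 ≈ v 0 → u 1 ≈ v 1 → ∀ m → u m ≈ v m
  Satisfies-unique {p} {q} {u} {v} u-rec v-rec u₀≈v₀ u₁≈v₁ m = proj₁ (agree m)
    where
    agree : ∀ m → u m ≈ v m × u (suc m) ≈ v (suc m)
    agree zero    = u₀≈v₀ , u₁≈v₁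
    agree (suc m) with agree m
    ... | uₘ≈vₘ , uₘ₊₁≈vₘ₊₁ = uₘ₊₁≈vₘ₊₁ , (begin
      u (suc (suc m))            ≈⟨ u-rec m ⟩
      p * u (suc m) - q * u m    ≈⟨ +-cong (*-congˡ uₘ₊₁≈vₘ₊₁) (-‿cong (*-congˡ uₘ≈vₘ)) ⟩
      p * v (suc m) - q * v m    ≈⟨ sym (v-rec m) ⟩
      v (suc (suc m))            ∎)

  powerSum-satisfies : ∀ α₊ α₋ β₊ β₋ →
    Satisfies (β₊ + β₋) (β₊ * β₋) (λ m → α₊ * pow β₊ m + α₋ * pow β₋ m)
  powerSum-satisfies α₊ α₋ β₊ β₋ m = solve 6
    (λ a₊ a₋ b₊ b₋ P₊ P₋ →
      a₊ :* (b₊ :* (b₊ :* P₊)) :+ a₋ :* (b₋ :* (b₋ :* P₋))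
      := (b₊ :+ b₋) :* (a₊ :* (b₊ :* P₊) :+ a₋ :* (b₋ :* P₋))
         :- b₊ :* b₋ :* (a₊ :* P₊ :+ a₋ :* P₋))
    refl α₊ α₋ β₊ β₋ (pow β₊ m) (pow β₋ m)

  -- Cayley–Hamilton for the 2 × 2 transfer matrix [[a, b], [c, d]].
  transfer-satisfies : ∀ {u v : ℕ → Carrier} a b c d →
    (∀ k → u (suc k) ≈ a * u k + b * v k) → (∀ k → v (suc k) ≈ c * u k + d * v k) →
    Satisfies (a + d) (a * d - b * c) u
  transfer-satisfies {u} {v} a b c d u-step v-step k = begin
    u (suc (suc k))                                    ≈⟨ u-step (suc k) ⟩
    a * u (suc k) + b * v (suc k)                      ≈⟨ +-cong (*-congˡ (u-step k)) (*-congˡ (v-step k)) ⟩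
    a * (a * u k + b * v k) + b * (c * u k + d * v k)
      ≈⟨ solve 6 (λ A B C D U V →
           A :* (A :* U :+ B :* V) :+ B :* (C :* U :+ D :* V)
           := (A :+ D) :* (A :* U :+ B :* V) :- (A :* D :- B :* C) :* U) refl a b c d (u k) (v k) ⟩
    (a + d) * (a * u k + b * v k) - (a * d - b * c) * u k
      ≈⟨ +-congʳ (*-congˡ (sym (u-step k))) ⟩
    (a + d) * u (suc k) - (a * d - b * c) * u k        ∎

shift : ℕ × ℕ → ℕ × ℕ
shift (i , j) = (suc i , suc j)

enumVertex : ℕ → ℕ × ℕ
enumVertex 0 = (0 , 0)
enumVertex 1 = (0 , 1)
enumVertex 2 = (1 , 0)
enumVertex (suc (suc (suc r))) = shift (enumVertex r)

private
  row : ℕ → ℕ → List (ℕ × ℕ)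
  row m i = List.map (i ,_) (filterᵇ (near i) (upTo (suc m)))

  filterᵇ-map : ∀ {A B : Set} (p : B → Bool) (f : A → B) xs →
                filterᵇ p (List.map f xs) ≡ List.map f (filterᵇ (p ∘ f) xs)
  filterᵇ-map p f []       = ≡.refl
  filterᵇ-map p f (a ∷ xs) with p (f a)
  ... | true  = ≡.cong (f a ∷_) (filterᵇ-map p f xs)
  ... | false = filterᵇ-map p f xs

  applyUpTo-cong : ∀ {A : Set} {f g : ℕ → A} → (∀ i → f i ≡ g i) → ∀ n →
                   applyUpTo f n ≡ applyUpTo g n
  applyUpTo-cong f≡g zero    = ≡.refl
  applyUpTo-cong f≡g (suc n) = ≡.cong₂ _∷_ (f≡g 0) (applyUpTo-cong (f≡g ∘ suc) n)

  concatMap-applyUpTo : ∀ {A : Set} (g : ℕ → List A) (f : ℕ → ℕ) n →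
                        concatMap g (applyUpTo f n) ≡ concat (applyUpTo (g ∘ f) n)
  concatMap-applyUpTo g f n = ≡.cong concat (Listₚ.map-applyUpTo f g n)

  near0-beyond1 : ∀ (f : ℕ → ℕ) m → filterᵇ (near 0) (applyUpTo (suc ∘ suc ∘ f) m) ≡ []
  near0-beyond1 f zero    = ≡.refl
  near0-beyond1 f (suc m) = near0-beyond1 (f ∘ suc) m

  row-zero : ∀ m → row (suc m) 0 ≡ (0 , 0) ∷ (0 , 1) ∷ []
  row-zero m = ≡.cong (λ js → (0 , 0) ∷ (0 , 1) ∷ List.map (0 ,_) js) (near0-beyond1 (λ j → j) m)

  row-shift : ∀ m i →
    List.map (suc i ,_) (filterᵇ (near (suc i)) (applyUpTo suc (suc m))) ≡ List.map shift (row m i)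
  row-shift m i = begin
    List.map (suc i ,_) (filterᵇ (near (suc i)) (applyUpTo suc (suc m)))
      ≡⟨ ≡.cong (List.map (suc i ,_) ∘ filterᵇ (near (suc i))) (≡.sym (Listₚ.map-upTo suc (suc m))) ⟩
    List.map (suc i ,_) (filterᵇ (near (suc i)) (List.map suc (upTo (suc m))))
      ≡⟨ ≡.cong (List.map (suc i ,_)) (filterᵇ-map (near (suc i)) suc (upTo (suc m))) ⟩
    List.map (suc i ,_) (List.map suc (filterᵇ (near i) (upTo (suc m))))
      ≡⟨ ≡.sym (Listₚ.map-∘ {g = suc i ,_} {f = suc} (filterᵇ (near i) (upTo (suc m)))) ⟩
    List.map (shift ∘ (i ,_)) (filterᵇ (near i) (upTo (suc m)))
      ≡⟨ Listₚ.map-∘ {g = shift} {f = i ,_} (filterᵇ (near i) (upTo (suc m))) ⟩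
    List.map shift (row m i) ∎
    where open ≡.≡-Reasoning

  row-suc : ∀ m i → row (suc m) (suc i) ≡
            List.map (suc i ,_) (filterᵇ (near (suc i)) [ 0 ]) ++ List.map shift (row m i)
  row-suc m zero    = ≡.cong ((1 , 0) ∷_) (row-shift m 0)
  row-suc m (suc i) = row-shift m (suc i)

vertices-suc : ∀ m → vertices (suc m) ≡ (0 , 0) ∷ (0 , 1) ∷ (1 , 0) ∷ List.map shift (vertices m)
vertices-suc m = begin
  row (suc m) 0 ++ concatMap (row (suc m)) (applyUpTo suc (suc m))
    ≡⟨ ≡.cong₂ _++_ (row-zero m) (concatMap-applyUpTo (row (suc m)) suc (suc m)) ⟩
  (0 , 0) ∷ (0 , 1) ∷ concat (applyUpTo (row (suc m) ∘ suc) (suc m))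
    ≡⟨ ≡.cong (λ rs → (0 , 0) ∷ (0 , 1) ∷ concat rs) (applyUpTo-cong (row-suc m) (suc m)) ⟩
  (0 , 0) ∷ (0 , 1) ∷ (1 , 0) ∷
    List.map shift (row m 0) ++ concat (applyUpTo (List.map shift ∘ row m ∘ suc) m)
    ≡⟨ ≡.cong (λ rs → (0 , 0) ∷ (0 , 1) ∷ (1 , 0) ∷ List.map shift (row m 0) ++ rs)
              (≡.sym (concatMap-applyUpTo (List.map shift ∘ row m) suc m)) ⟩
  (0 , 0) ∷ (0 , 1) ∷ (1 , 0) ∷ concatMap (List.map shift ∘ row m) (upTo (suc m))
    ≡⟨ ≡.cong (λ vs → (0 , 0) ∷ (0 , 1) ∷ (1 , 0) ∷ vs)
              (≡.sym (Listₚ.map-concatMap shift (row m) (upTo (suc m)))) ⟩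
  (0 , 0) ∷ (0 , 1) ∷ (1 , 0) ∷ List.map shift (vertices m) ∎
  where open ≡.≡-Reasoning

vertices-enumerated : ∀ m → vertices m ≡ applyUpTo enumVertex (suc (m ℕ.* 3))
vertices-enumerated zero    = ≡.refl
vertices-enumerated (suc m) = ≡.trans (vertices-suc m) (≡.cong (λ vs → (0 , 0) ∷ (0 , 1) ∷ (1 , 0) ∷ vs)
  (≡.trans (≡.cong (List.map shift) (vertices-enumerated m))
           (Listₚ.map-applyUpTo enumVertex shift (suc (m ℕ.* 3)))))

vertex-enumerated : ∀ m (p : Fin (nV m)) → vertex m p ≡ enumVertex (toℕ p)
vertex-enumerated m = lookup-enumerated (vertices-enumerated m)
  where
  lookup-enumerated : ∀ {vs n} → vs ≡ applyUpTo enumVertex n → ∀ p →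
                      List.lookup vs p ≡ enumVertex (toℕ p)
  lookup-enumerated {n = n} ≡.refl = Listₚ.lookup-applyUpTo enumVertex n

nV-enumerated : ∀ m → nV m ≡ suc (m ℕ.* 3)
nV-enumerated m =
  ≡.trans (≡.cong List.length (vertices-enumerated m)) (Listₚ.length-applyUpTo enumVertex _)

inSupport : ℕ → ℕ → Bool
inSupport r c = edge (enumVertex r) (enumVertex c) ∨ (r ≡ᵇ c)

-- Columns 3i, 3i + 1, 3i + 2 are the vertices (i , i), (i , i + 1), (i + 1 , i); the last
-- rows meeting them are those of (i + 1 , i), (i , i + 1), (i + 2 , i + 1).
lastNonzeroRow : ℕ → ℕ
lastNonzeroRow 0 = 2
lastNonzeroRow 1 = 1
lastNonzeroRow 2 = 5
lastNonzeroRow (suc (suc (suc c))) = 3 ℕ.+ lastNonzeroRow c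

inSupport-below : ∀ c d → inSupport (suc (lastNonzeroRow c) ℕ.+ d) c ≡ false
inSupport-below 0 d                   = ≡.refl
inSupport-below 1 zero                = ≡.refl
inSupport-below 1 (suc d)             = ≡.refl
inSupport-below 2 d                   = ≡.refl
inSupport-below (suc (suc (suc c))) d = inSupport-below c d

inSupport-right : ∀ r d → inSupport r (r ℕ.+ 4 ℕ.+ d) ≡ false
inSupport-right 0 d                   = ≡.refl
inSupport-right 1 zero                = ≡.refl
inSupport-right 1 (suc d)             = ≡.refl
inSupport-right 2 d                   = ≡.refl
inSupport-right (suc (suc (suc r))) d = inSupport-right r d

module CharacteristicDeterminant {c ℓ} (R : CommutativeRing c ℓ) (x : CommutativeRing.Carrier R) where

  open CommutativeRing R
  open RingOps R
  open Transfer R using (a; I)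
  open Minors R
  open LinearRecurrences R
  open IntegerCoefficients R
  open import Relation.Binary.Reasoning.Setoid setoid

  entry : ℕ → ℕ → Carrier
  entry r c = fromBool (edge (enumVertex r) (enumVertex c)) - x * fromBool (r ≡ᵇ c)

  entry-periodic : ∀ r c → entry (3 ℕ.+ r) (3 ℕ.+ c) ≡ entry r c
  entry-periodic r c = ≡.refl

  entry-outsideSupport : ∀ r c → inSupport r c ≡ false → entry r c ≈ 0#
  entry-outsideSupport r c outside with edge (enumVertex r) (enumVertex c) | r ≡ᵇ c | outside
  ... | false | false | _ = trans (+-congˡ (-‿cong (zeroʳ x))) (-‿inverseʳ 0#)

  entry-belowLast : ∀ {r c} → lastNonzeroRow c < r → entry r c ≈ 0#
  entry-belowLast {c = c} last<r with ℕₚ.m≤n⇒∃[o]m+o≡n last<r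
  ... | d , ≡.refl = entry-outsideSupport (suc (lastNonzeroRow c) ℕ.+ d) c (inSupport-below c d)

  entry-rightOfBand : ∀ {r c} → r ℕ.+ 4 ≤ c → entry r c ≈ 0#
  entry-rightOfBand {r} r+4≤c with ℕₚ.m≤n⇒∃[o]m+o≡n r+4≤c
  ... | d , ≡.refl = entry-outsideSupport r (r ℕ.+ 4 ℕ.+ d) (inSupport-right r d)

  a≈minor : ∀ m → a m x ≈ minor entry 0 (iterate suc 0 (suc (m ℕ.* 3)))
  a≈minor m = begin
    a m x
      ≈⟨ det-cong (nV m) (λ p q → reflexive (≡.cong₂ (λ u v → fromBool (edge u v) - x * I m p q)
                                                      (vertex-enumerated m p) (vertex-enumerated m q))) ⟩
    principal (nV m)           ≡⟨ ≡.cong principal (nV-enumerated m) ⟩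
    principal (suc (m ℕ.* 3))  ≈⟨ principal≈minor (suc (m ℕ.* 3)) ⟩
    minor entry 0 (iterate suc 0 (suc (m ℕ.* 3))) ∎
    where
    principal : ℕ → Carrier
    principal n = det n (λ p q → entry (toℕ p) (toℕ q))
    principal≈minor : ∀ n → principal n ≈ minor entry 0 (iterate suc 0 n)
    principal≈minor n = trans
      (det-cong n (λ p q → reflexive (≡.cong (entry (toℕ p)) (≡.sym (lookup-iterate-suc 0 n q)))))
      (det≈minor entry 0 (iterate suc 0 n))

  Expansion : ℕ → ℕ → Set
  Expansion n w = List (Polynomial (suc n) × Vec ℕ w)

  evaluate : ∀ {n w t} → ℕ → Vec ℕ t → Vec Carrier n → Expansion n w → Carrier
  evaluate r T ρ []             = 0#
  evaluate r T ρ ((p , W) ∷ ps) = ⟦ p ⟧ (x ∷ ρ) * minor entry r (W Vec.++ T) + evaluate r T ρ ps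

  X : ∀ {n} → Polynomial (suc n)
  X = var Fin.zero

  private
    bool→ℤ : Bool → ℤ
    bool→ℤ true  = + 1
    bool→ℤ false = + 0

    fromℤ-bool : ∀ b → fromℤ (bool→ℤ b) ≈ fromBool b
    fromℤ-bool true  = refl
    fromℤ-bool false = refl

  entryₚ : ∀ {n} → ℕ → ℕ → Polynomial (suc n)
  entryₚ r c = con (bool→ℤ (edge (enumVertex r) (enumVertex c))) :- X :* con (bool→ℤ (r ≡ᵇ c))

  ⟦entryₚ⟧ : ∀ {n} r c (ρ : Vec Carrier n) → ⟦ entryₚ r c ⟧ (x ∷ ρ) ≈ entry r c
  ⟦entryₚ⟧ r c ρ =
    +-cong (fromℤ-bool (edge (enumVertex r) (enumVertex c))) (-‿cong (*-congˡ (fromℤ-bool (r ≡ᵇ c))))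

  altₚ : ∀ {n} → ℕ → Polynomial n → Polynomial n
  altₚ zero    p = p
  altₚ (suc j) p = :- altₚ j p

  ⟦altₚ⟧ : ∀ {n} j (p : Polynomial n) ρ → ⟦ altₚ j p ⟧ ρ ≡ alt j (⟦ p ⟧ ρ)
  ⟦altₚ⟧ zero    p ρ = ≡.refl
  ⟦altₚ⟧ (suc j) p ρ = ≡.cong -_ (⟦altₚ⟧ j p ρ)

  vanished? : ∀ {w} r (W : Vec ℕ w) → Dec (Any (λ c → lastNonzeroRow c < r) W)
  vanished? r = any? (λ c → lastNonzeroRow c <? r)

  -- Laplace expansion along row r of the minor with columns W ++ T, for a tail T to
  -- the right of the band, with coefficients polynomials in x (variable 0). Terms
  -- with a zero entry, or whose minor keeps a column vanishing from row r + 1 on,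
  -- are dropped.
  rowTerm : ∀ {n w} → ℕ → Vec ℕ (suc w) → Fin (suc w) → Expansion n w
  rowTerm r W j with inSupport r (lookup W j) | vanished? (suc r) (removeAt W j)
  ... | true | no _ = [ (altₚ (toℕ j) (entryₚ r (lookup W j)) , removeAt W j) ]
  ... | _    | _    = []

  expandRow : ∀ {n w} → ℕ → Vec ℕ (suc w) → Expansion n w
  expandRow r W = concat (List.tabulate (rowTerm r W))

  expand : ∀ {n w} → ℕ → ∀ s → Vec ℕ (s ℕ.+ w) → Expansion n w
  expand r zero    W = [ (con (+ 1) , W) ]
  expand r (suc s) W =
    concatMap (λ (p , V) → List.map (Product.map₁ (p :*_)) (expand (suc r) s V)) (expandRow r W)

  module _ {n w t : ℕ} (r : ℕ) (T : Vec ℕ t) (ρ : Vec Carrier n) where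

    evaluate-++ : (ps qs : Expansion n w) →
                  evaluate r T ρ (ps ++ qs) ≈ evaluate r T ρ ps + evaluate r T ρ qs
    evaluate-++ []             qs = sym (+-identityˡ _)
    evaluate-++ ((p , W) ∷ ps) qs = trans (+-congˡ (evaluate-++ ps qs)) (sym (+-assoc _ _ _))

    evaluate-scale : ∀ p (ps : Expansion n w) →
      evaluate r T ρ (List.map (Product.map₁ (p :*_)) ps) ≈ ⟦ p ⟧ (x ∷ ρ) * evaluate r T ρ ps
    evaluate-scale p []             = sym (zeroʳ _)
    evaluate-scale p ((q , W) ∷ ps) = begin
      ⟦ p ⟧ (x ∷ ρ) * ⟦ q ⟧ (x ∷ ρ) * minor entry r (W Vec.++ T) + evaluate r T ρ (List.map _ ps)
        ≈⟨ +-cong (*-assoc _ _ _) (evaluate-scale p ps) ⟩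
      ⟦ p ⟧ (x ∷ ρ) * (⟦ q ⟧ (x ∷ ρ) * minor entry r (W Vec.++ T)) + ⟦ p ⟧ (x ∷ ρ) * evaluate r T ρ ps
        ≈⟨ sym (distribˡ _ _ _) ⟩
      ⟦ p ⟧ (x ∷ ρ) * evaluate r T ρ ((q , W) ∷ ps) ∎

    evaluate-concat-tabulate : ∀ k (f : Fin k → Expansion n w) →
      evaluate r T ρ (concat (List.tabulate f)) ≈ sumFin k (λ j → evaluate r T ρ (f j))
    evaluate-concat-tabulate zero    f = refl
    evaluate-concat-tabulate (suc k) f =
      trans (evaluate-++ (f Fin.zero) _) (+-congˡ (evaluate-concat-tabulate k (f ∘ Fin.suc)))

  rowTerm-correct : ∀ {n w t} r (W : Vec ℕ (suc w)) (T : Vec ℕ t) (ρ : Vec Carrier n) j →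
    alt (toℕ j) (entry r (lookup W j) * minor entry (suc r) (removeAt W j Vec.++ T)) ≈
    evaluate (suc r) T ρ (rowTerm r W j)
  rowTerm-correct r W T ρ j with inSupport r (lookup W j) in supported | vanished? (suc r) (removeAt W j)
  ... | true  | no _ = begin
    alt (toℕ j) (entry r cⱼ * D)                 ≈⟨ alt-*ˡ (toℕ j) _ D ⟩
    alt (toℕ j) (entry r cⱼ) * D                 ≈⟨ *-congʳ (alt-cong (toℕ j) (sym (⟦entryₚ⟧ r cⱼ ρ))) ⟩
    alt (toℕ j) (⟦ entryₚ r cⱼ ⟧ (x ∷ ρ)) * D    ≈⟨ *-congʳ (reflexive (≡.sym (⟦altₚ⟧ (toℕ j) _ (x ∷ ρ)))) ⟩
    ⟦ altₚ (toℕ j) (entryₚ r cⱼ) ⟧ (x ∷ ρ) * D   ≈⟨ sym (+-identityʳ _) ⟩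
    ⟦ altₚ (toℕ j) (entryₚ r cⱼ) ⟧ (x ∷ ρ) * D + 0# ∎
    where
    cⱼ = lookup W j
    D = minor entry (suc r) (removeAt W j Vec.++ T)
  ... | false | _ = alt-zero (toℕ j) (trans (*-congʳ (entry-outsideSupport r (lookup W j) supported)) (zeroˡ _))
  ... | true  | yes vanished with find vanished
  ... | c , c∈W , last<r = alt-zero (toℕ j) (trans (*-congˡ vanishing-minor) (zeroʳ _))
    where
    vanishing-minor : minor entry (suc r) (removeAt W j Vec.++ T) ≈ 0#
    vanishing-minor = minor-zeroColumn entry (suc r) _ (∈-++⁺ˡ c∈W)
                        (λ r≤r′ → entry-belowLast (ℕₚ.<-≤-trans last<r r≤r′))

  expandRow-correct : ∀ {n w t} r (W : Vec ℕ (suc w)) b (ρ : Vec Carrier n) → r ℕ.+ 4 ≤ b →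
    minor entry r (W Vec.++ iterate suc b t) ≈ evaluate (suc r) (iterate suc b t) ρ (expandRow r W)
  expandRow-correct {w = w} {t} r W b ρ r+4≤b = begin
    minor entry r (W Vec.++ T)
      ≈⟨ minor-window entry r W T tail-vanishes ⟩
    sumFin (suc w) (λ j → alt (toℕ j) (entry r (lookup W j) * minor entry (suc r) (removeAt W j Vec.++ T)))
      ≈⟨ sumFin-cong (suc w) (rowTerm-correct r W T ρ) ⟩
    sumFin (suc w) (λ j → evaluate (suc r) T ρ (rowTerm r W j))
      ≈⟨ sym (evaluate-concat-tabulate (suc r) T ρ (suc w) (rowTerm r W)) ⟩
    evaluate (suc r) T ρ (expandRow r W) ∎
    where
    T = iterate suc b t
    tail-vanishes : ∀ j → entry r (lookup T j) ≈ 0#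
    tail-vanishes j rewrite lookup-iterate-suc b t j =
      entry-rightOfBand (ℕₚ.≤-trans r+4≤b (ℕₚ.m≤m+n b (toℕ j)))

  expand-correct : ∀ {n w t} r s (W : Vec ℕ (s ℕ.+ w)) b (ρ : Vec Carrier n) → r ℕ.+ (s ℕ.+ 3) ≤ b →
    minor entry r (W Vec.++ iterate suc b t) ≈ evaluate (r ℕ.+ s) (iterate suc b t) ρ (expand r s W)
  expand-correct {t = t} r zero W b ρ _ = begin
    minor entry r (W Vec.++ T)                 ≈⟨ sym (*-identityˡ _) ⟩
    1# * minor entry r (W Vec.++ T)
      ≡⟨ ≡.cong (λ r′ → 1# * minor entry r′ (W Vec.++ T)) (≡.sym (ℕₚ.+-identityʳ r)) ⟩
    1# * minor entry (r ℕ.+ 0) (W Vec.++ T)    ≈⟨ sym (+-identityʳ _) ⟩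
    evaluate (r ℕ.+ 0) T ρ (expand r 0 W)      ∎
    where T = iterate suc b t
  expand-correct {t = t} r (suc s) W b ρ bound = begin
    minor entry r (W Vec.++ T)
      ≈⟨ expandRow-correct r W b ρ (ℕₚ.≤-trans (ℕₚ.+-monoʳ-≤ r (s≤s (ℕₚ.m≤n+m 3 s))) bound) ⟩
    evaluate (suc r) T ρ (expandRow r W)
      ≈⟨ expand-rest (expandRow r W) ⟩
    evaluate (suc r ℕ.+ s) T ρ (expand r (suc s) W)
      ≡⟨ ≡.cong (λ r′ → evaluate r′ T ρ (expand r (suc s) W)) (≡.sym (ℕₚ.+-suc r s)) ⟩
    evaluate (r ℕ.+ suc s) T ρ (expand r (suc s) W) ∎
    where
    T = iterate suc b t
    bound′ : suc r ℕ.+ (s ℕ.+ 3) ≤ b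
    bound′ = ℕₚ.≤-trans (ℕₚ.≤-reflexive (≡.sym (ℕₚ.+-suc r (s ℕ.+ 3)))) bound
    expand-rest : ∀ ps → evaluate (suc r) T ρ ps ≈ evaluate (suc r ℕ.+ s) T ρ
      (concatMap (λ (p , V) → List.map (Product.map₁ (p :*_)) (expand (suc r) s V)) ps)
    expand-rest []             = refl
    expand-rest ((p , V) ∷ ps) = begin
      ⟦ p ⟧ (x ∷ ρ) * minor entry (suc r) (V Vec.++ T) + evaluate (suc r) T ρ ps
        ≈⟨ +-cong (*-congˡ (expand-correct (suc r) s V b ρ bound′)) (expand-rest ps) ⟩
      ⟦ p ⟧ (x ∷ ρ) * evaluate (suc r ℕ.+ s) T ρ (expand (suc r) s V) + _
        ≈⟨ +-congʳ (sym (evaluate-scale (suc r ℕ.+ s) T ρ p (expand (suc r) s V))) ⟩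
      _ + _
        ≈⟨ sym (evaluate-++ (suc r ℕ.+ s) T ρ (List.map (Product.map₁ (p :*_)) (expand (suc r) s V)) _) ⟩
      _ ∎

  -- Variable i + 1 of the readout stands for the minor with window lookup atoms i;
  -- the readout fails if some other window occurs.
  readout : ∀ {n w} → Vec (Vec ℕ w) n → Expansion n w → Maybe (Polynomial (suc n))
  readout atoms []             = just (con (+ 0))
  readout atoms ((p , W) ∷ ps) with any? (Vecₚ.≡-dec ℕ._≟_ W) atoms | readout atoms ps
  ... | yes W∈atoms | just q = just (p :* var (Fin.suc (Any.index W∈atoms)) :+ q)
  ... | _           | _      = nothing

  readout-correct : ∀ {n w t} r (T : Vec ℕ t) (atoms : Vec (Vec ℕ w) n) ps {q} →
    readout atoms ps ≡ just q →
    let ρ = Vec.map (λ A → minor entry r (A Vec.++ T)) atoms in ⟦ q ⟧ (x ∷ ρ) ≈ evaluate r T ρ ps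
  readout-correct r T atoms [] ≡.refl = refl
  readout-correct r T atoms ((p , W) ∷ ps) read
    with any? (Vecₚ.≡-dec ℕ._≟_ W) atoms | readout atoms ps in read-rest
  readout-correct r T atoms ((p , W) ∷ ps) ≡.refl | yes W∈atoms | just q =
    +-cong (*-congˡ (reflexive atom)) (readout-correct r T atoms ps read-rest)
    where
    i = Any.index W∈atoms
    atom : lookup (Vec.map (λ A → minor entry r (A Vec.++ T)) atoms) i ≡ minor entry r (W Vec.++ T)
    atom = ≡.trans (Vecₚ.lookup-map i _ atoms)
                   (≡.cong (λ A → minor entry r (A Vec.++ T)) (≡.sym (Anyₚ.lookup-index W∈atoms)))

  readoutClosed : ∀ {n} → Expansion n 0 → Polynomial (suc n)
  readoutClosed []              = con (+ 0)
  readoutClosed ((p , []) ∷ ps) = p :+ readoutClosed ps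

  readoutClosed-correct : ∀ {n} r (ρ : Vec Carrier n) ps →
                          ⟦ readoutClosed ps ⟧ (x ∷ ρ) ≈ evaluate r [] ρ ps
  readoutClosed-correct r ρ []              = refl
  readoutClosed-correct r ρ ((p , []) ∷ ps) = +-cong
    (sym (trans (*-congˡ (reflexive (minor-[] entry r))) (*-identityʳ _)))
    (readoutClosed-correct r ρ ps)

  -- In the three lemmas below the hypotheses are checked by evaluation: ≡.refl
  -- for the readout, refl for the comparison of normal forms.
  minor≈expansion : ∀ {n w} r s (W : Vec ℕ (s ℕ.+ w)) t (atoms : Vec (Vec ℕ w) n)
                    (e : Polynomial (suc n)) {q} → readout atoms (expand r s W) ≡ just q →
    let T = iterate suc (r ℕ.+ (s ℕ.+ 3)) t
        ρ = x ∷ Vec.map (λ A → minor entry (r ℕ.+ s) (A Vec.++ T)) atoms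
    in ⟦ q ⟧↓ ρ ≈ ⟦ e ⟧↓ ρ → minor entry r (W Vec.++ T) ≈ ⟦ e ⟧ ρ
  minor≈expansion r s W t atoms e {q} read normal-forms = begin
    minor entry r (W Vec.++ T)               ≈⟨ expand-correct r s W _ ρ ℕₚ.≤-refl ⟩
    evaluate (r ℕ.+ s) T ρ (expand r s W)    ≈⟨ sym (readout-correct (r ℕ.+ s) T atoms (expand r s W) read) ⟩
    ⟦ q ⟧ (x ∷ ρ)                            ≈⟨ prove (x ∷ ρ) q e normal-forms ⟩
    ⟦ e ⟧ (x ∷ ρ)                            ∎
    where
    T = iterate suc (r ℕ.+ (s ℕ.+ 3)) t
    ρ = Vec.map (λ A → minor entry (r ℕ.+ s) (A Vec.++ T)) atoms

  minor≈blockTransfer : ∀ {n} (W : Vec ℕ 6) (atoms : Vec (Vec ℕ 3) n) (e : Polynomial (suc n)) {q} →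
    readout (Vec.map (Vec.map (3 ℕ.+_)) atoms) (expand 3 3 W) ≡ just q →
    (∀ ρ → ⟦ q ⟧↓ ρ ≈ ⟦ e ⟧↓ ρ) →
    ∀ t → minor entry 3 (W Vec.++ iterate suc 9 t) ≈
          ⟦ e ⟧ (x ∷ Vec.map (λ A → minor entry 3 (A Vec.++ iterate suc 6 t)) atoms)
  minor≈blockTransfer W atoms e read normal-forms t = begin
    minor entry 3 (W Vec.++ iterate suc 9 t)
      ≈⟨ minor≈expansion 3 3 W t _ e read (normal-forms _) ⟩
    ⟦ e ⟧ (x ∷ Vec.map (λ A → minor entry 6 (A Vec.++ iterate suc 9 t)) (Vec.map (Vec.map (3 ℕ.+_)) atoms))
      ≡⟨ ≡.cong (λ ρ → ⟦ e ⟧ (x ∷ ρ))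
                (≡.trans (≡.sym (Vecₚ.map-∘ _ _ atoms)) (Vecₚ.map-cong shifted atoms)) ⟩
    ⟦ e ⟧ (x ∷ Vec.map (λ A → minor entry 3 (A Vec.++ iterate suc 6 t)) atoms) ∎
    where
    shifted : ∀ A → minor entry (3 ℕ.+ 3) (Vec.map (3 ℕ.+_) A Vec.++ iterate suc 9 t) ≡
                    minor entry 3 (A Vec.++ iterate suc 6 t)
    shifted A = ≡.trans
      (≡.cong (λ T → minor entry 6 (Vec.map (3 ℕ.+_) A Vec.++ T)) (≡.sym (map-iterate-suc 3 6 t)))
      (≡.trans (≡.cong (minor entry 6) (≡.sym (Vecₚ.map-++ (3 ℕ.+_) A (iterate suc 6 t))))
               (minor-shift entry 3 entry-periodic 3 (A Vec.++ iterate suc 6 t)))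

  minor≈polynomial : ∀ r s (W : Vec ℕ (s ℕ.+ 0)) (e : Polynomial 1) →
    (∀ ρ → ⟦ readoutClosed (expand r s W) ⟧↓ ρ ≈ ⟦ e ⟧↓ ρ) →
    minor entry r (W Vec.++ []) ≈ ⟦ e ⟧ (x ∷ [])
  minor≈polynomial r s W e normal-forms = begin
    minor entry r (W Vec.++ [])
      ≈⟨ expand-correct {t = 0} r s W (r ℕ.+ (s ℕ.+ 3)) [] ℕₚ.≤-refl ⟩
    evaluate (r ℕ.+ s) [] [] (expand r s W)
      ≈⟨ sym (readoutClosed-correct (r ℕ.+ s) [] (expand r s W)) ⟩
    ⟦ readoutClosed (expand r s W) ⟧ (x ∷ [])
      ≈⟨ prove (x ∷ []) (readoutClosed (expand r s W)) e (normal-forms _) ⟩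
    ⟦ e ⟧ (x ∷ []) ∎

  τ : Carrier
  τ = - pow x 3 + pow x 2 - x - 1#

  τₚ : ∀ {n} → Polynomial n → Polynomial n
  τₚ y = :- powₚ y 3 :+ powₚ y 2 :- y :- con (+ 1)

  a₁ₚ : ∀ {n} → Polynomial n → Polynomial n
  a₁ₚ y = powₚ y 4 :- twoₚ :* powₚ y 3 :+ powₚ y 2 :- con (+ 1)

  σ π κ δ : ℕ → Carrier
  σ k = minor entry 3 (3 ∷ 4 ∷ 5 ∷ iterate suc 6 (suc (k ℕ.* 3)))
  π k = minor entry 3 (2 ∷ 3 ∷ 5 ∷ iterate suc 6 (suc (k ℕ.* 3)))
  κ k = minor entry 3 (2 ∷ 4 ∷ 5 ∷ iterate suc 6 (suc (k ℕ.* 3)))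
  δ k = π k - κ k

  private
    windows : Vec (Vec ℕ 3) 3
    windows = (3 ∷ 4 ∷ 5 ∷ []) ∷ (2 ∷ 3 ∷ 5 ∷ []) ∷ (2 ∷ 4 ∷ 5 ∷ []) ∷ []

    σₚ πₚ κₚ : Polynomial 4
    σₚ = var (Fin.suc Fin.zero)
    πₚ = var (Fin.suc (Fin.suc Fin.zero))
    κₚ = var (Fin.suc (Fin.suc (Fin.suc Fin.zero)))

  σ-step : ∀ k → σ (suc k) ≈ (x * x - x * x * x) * σ k + 1# * δ k
  σ-step k = minor≈blockTransfer (3 ∷ 4 ∷ 5 ∷ 6 ∷ 7 ∷ 8 ∷ []) windows
    ((X :* X :- X :* X :* X) :* σₚ :+ con (+ 1) :* (πₚ :- κₚ)) ≡.refl (λ _ → refl) (suc (k ℕ.* 3))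

  π-step : ∀ k → π (suc k) ≈ x * κ k - x * π k
  π-step k = minor≈blockTransfer (2 ∷ 3 ∷ 5 ∷ 6 ∷ 7 ∷ 8 ∷ []) windows
    (X :* κₚ :- X :* πₚ) ≡.refl (λ _ → refl) (suc (k ℕ.* 3))

  κ-step : ∀ k → κ (suc k) ≈ x * x * σ k + π k - κ k
  κ-step k = minor≈blockTransfer (2 ∷ 4 ∷ 5 ∷ 6 ∷ 7 ∷ 8 ∷ []) windows
    (X :* X :* σₚ :+ πₚ :- κₚ) ≡.refl (λ _ → refl) (suc (k ℕ.* 3))

  δ-step : ∀ k → δ (suc k) ≈ - (x * x) * σ k + - (1# + x) * δ k
  δ-step k = begin
    π (suc k) - κ (suc k)                             ≈⟨ +-cong (π-step k) (-‿cong (κ-step k)) ⟩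
    (x * κ k - x * π k) - (x * x * σ k + π k - κ k)
      ≈⟨ solve 4 (λ y s p q → (y :* q :- y :* p) :- (y :* y :* s :+ p :- q)
                              := :- (y :* y) :* s :+ :- (con (+ 1) :+ y) :* (p :- q))
               refl x (σ k) (π k) (κ k) ⟩
    - (x * x) * σ k + - (1# + x) * δ k                ∎

  σ-satisfies : Satisfies τ (pow x 4) σ
  σ-satisfies = Satisfies-cong
    (solve 1 (λ y → (y :* y :- y :* y :* y) :+ :- (con (+ 1) :+ y) := τₚ y) refl x)
    (solve 1 (λ y → (y :* y :- y :* y :* y) :* :- (con (+ 1) :+ y) :- con (+ 1) :* :- (y :* y)
                    := powₚ y 4) refl x)
    (transfer-satisfies (x * x - x * x * x) 1# (- (x * x)) (- (1# + x)) σ-step δ-step)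

  a≈σ : ∀ k → a (suc k) x ≈ σ k
  a≈σ k = trans (a≈minor (suc k)) (reflexive (≡.sym (≡.trans
    (≡.cong (minor entry 3) (≡.sym (map-iterate-suc 3 0 n)))
    (minor-shift entry 3 entry-periodic 0 (iterate suc 0 n)))))
    where n = suc (suc k ℕ.* 3)

  a₀ : a 0 x ≈ 1# - x
  a₀ = trans (a≈minor 0) (minor≈polynomial 0 1 (0 ∷ []) (con (+ 1) :- X) (λ _ → refl))

  a₁ : a 1 x ≈ pow x 4 - (1# + 1#) * pow x 3 + pow x 2 - 1#
  a₁ = trans (a≈σ 0) (minor≈polynomial 3 4 (3 ∷ 4 ∷ 5 ∷ 6 ∷ []) (a₁ₚ X) (λ _ → refl))

  a-satisfies : Satisfies τ (pow x 4) (λ m → a m x)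
  a-satisfies zero = begin
    a 2 x
      ≈⟨ trans (a≈σ 1) (minor≈polynomial 3 7 (3 ∷ 4 ∷ 5 ∷ 6 ∷ 7 ∷ 8 ∷ 9 ∷ [])
                          (τₚ X :* a₁ₚ X :- powₚ X 4 :* (con (+ 1) :- X)) (λ _ → refl)) ⟩
    τ * (pow x 4 - (1# + 1#) * pow x 3 + pow x 2 - 1#) - pow x 4 * (1# - x)
      ≈⟨ sym (+-cong (*-congˡ a₁) (-‿cong (*-congˡ a₀))) ⟩
    τ * a 1 x - pow x 4 * a 0 x ∎
  a-satisfies (suc k) = begin
    a (3 ℕ.+ k) x   ≈⟨ a≈σ (2 ℕ.+ k) ⟩
    σ (2 ℕ.+ k)     ≈⟨ σ-satisfies k ⟩
    τ * σ (suc k) - pow x 4 * σ k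
      ≈⟨ sym (+-cong (*-congˡ (a≈σ (suc k))) (-‿cong (*-congˡ (a≈σ k)))) ⟩
    τ * a (2 ℕ.+ k) x - pow x 4 * a (suc k) x ∎

module ClosedForm {c ℓ} (R : CommutativeRing c ℓ) (x s t h : CommutativeRing.Carrier R) where

  open CommutativeRing R
  open RingOps R
  open IntegerCoefficients R
  open LinearRecurrences R
  open CharacteristicDeterminant R x using (τ; τₚ; a₁ₚ)
  open import Relation.Binary.Reasoning.Setoid setoid

  two W β₊ β₋ α₊ α₋ : Carrier
  two = 1# + 1#
  W   = pow x 4 - two * pow x 3 - 1#
  β₊  = (τ + s) * h
  β₋  = (τ - s) * h
  α₊  = W * t + (1# - x) * h
  α₋  = - (W * t) + (1# - x) * h

  closedForm : ℕ → Carrier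
  closedForm m = α₊ * pow β₊ m + α₋ * pow β₋ m

  private
    Wₚ : ∀ {n} → Polynomial n → Polynomial n
    Wₚ y = powₚ y 4 :- twoₚ :* powₚ y 3 :- con (+ 1)

  module _ (s² : s * s ≈ (pow x 4 - 1#) * (pow x 2 - two * x - 1#))
           (2h≈1 : two * h ≈ 1#) (2st≈1 : two * s * t ≈ 1#) where

    roots-sum : β₊ + β₋ ≈ τ
    roots-sum = begin
      (τ + s) * h + (τ - s) * h
        ≈⟨ solve 3 (λ y s h → (τₚ y :+ s) :* h :+ (τₚ y :- s) :* h := τₚ y :* (twoₚ :* h))
                   refl x s h ⟩
      τ * (two * h)              ≈⟨ *-congˡ 2h≈1 ⟩
      τ * 1#                     ≈⟨ *-identityʳ τ ⟩
      τ                          ∎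

    roots-product : β₊ * β₋ ≈ pow x 4
    roots-product = begin
      (τ + s) * h * ((τ - s) * h)
        ≈⟨ solve 3 (λ y s h → (τₚ y :+ s) :* h :* ((τₚ y :- s) :* h)
                              := (τₚ y :* τₚ y :- s :* s) :* (h :* h)) refl x s h ⟩
      (τ * τ - s * s) * (h * h)
        ≈⟨ *-congʳ (+-congˡ (-‿cong s²)) ⟩
      (τ * τ - (pow x 4 - 1#) * (pow x 2 - two * x - 1#)) * (h * h)
        ≈⟨ solve 2 (λ y h →
             (τₚ y :* τₚ y :- (powₚ y 4 :- con (+ 1)) :* (powₚ y 2 :- twoₚ :* y :- con (+ 1))) :* (h :* h)
             := powₚ y 4 :* ((twoₚ :* h) :* (twoₚ :* h))) refl x h ⟩
      pow x 4 * ((two * h) * (two * h))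
        ≈⟨ *-congˡ (trans (*-cong 2h≈1 2h≈1) (*-identityˡ 1#)) ⟩
      pow x 4 * 1#
        ≈⟨ *-identityʳ _ ⟩
      pow x 4 ∎

    closedForm-satisfies : Satisfies τ (pow x 4) closedForm
    closedForm-satisfies = Satisfies-cong roots-sum roots-product (powerSum-satisfies α₊ α₋ β₊ β₋)

    closedForm₀ : closedForm 0 ≈ 1# - x
    closedForm₀ = begin
      α₊ * 1# + α₋ * 1#
        ≈⟨ solve 3 (λ y t h →
             (Wₚ y :* t :+ (con (+ 1) :- y) :* h) :* con (+ 1)
             :+ (:- (Wₚ y :* t) :+ (con (+ 1) :- y) :* h) :* con (+ 1)
             := (con (+ 1) :- y) :* (twoₚ :* h)) refl x t h ⟩
      (1# - x) * (two * h)     ≈⟨ *-congˡ 2h≈1 ⟩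
      (1# - x) * 1#            ≈⟨ *-identityʳ _ ⟩
      1# - x                   ∎

    closedForm₁ : closedForm 1 ≈ pow x 4 - two * pow x 3 + pow x 2 - 1#
    closedForm₁ = begin
      α₊ * (β₊ * 1#) + α₋ * (β₋ * 1#)
        ≈⟨ solve 4 (λ y s t h →
             (Wₚ y :* t :+ (con (+ 1) :- y) :* h) :* ((τₚ y :+ s) :* h :* con (+ 1))
             :+ (:- (Wₚ y :* t) :+ (con (+ 1) :- y) :* h) :* ((τₚ y :- s) :* h :* con (+ 1))
             := Wₚ y :* h :* (twoₚ :* s :* t) :+ (con (+ 1) :- y) :* τₚ y :* h :* (twoₚ :* h))
           refl x s t h ⟩
      W * h * (two * s * t) + (1# - x) * τ * h * (two * h)
        ≈⟨ +-cong (*-congˡ 2st≈1) (*-congˡ 2h≈1) ⟩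
      W * h * 1# + (1# - x) * τ * h * 1#
        ≈⟨ solve 2 (λ y h → Wₚ y :* h :* con (+ 1) :+ (con (+ 1) :- y) :* τₚ y :* h :* con (+ 1)
                            := (twoₚ :* h) :* a₁ₚ y) refl x h ⟩
      (two * h) * (pow x 4 - two * pow x 3 + pow x 2 - 1#)
        ≈⟨ trans (*-congʳ 2h≈1) (*-identityˡ _) ⟩
      pow x 4 - two * pow x 3 + pow x 2 - 1# ∎

proposition2p4 : ∀ {c ℓ} (F : Field c ℓ) →
  let open Field F in
  let open RingOps commutativeRing in
  let open Transfer commutativeRing in
  let two = 1# + 1# in
  (m : ℕ) (x s t h : Carrier) →
  ¬ (x ≈ 1#) → ¬ (x ≈ - 1#) → ¬ (x * x ≈ - 1#) →
  ¬ (x * x - two * x - 1# ≈ 0#) →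
  s * s ≈ (pow x 4 - 1#) * (pow x 2 - two * x - 1#) →
  two * h ≈ 1# →
  (two * s) * t ≈ 1# →
  a m x ≈
    ((pow x 4 - two * pow x 3 - 1#) * t + (1# - x) * h)
      * pow ((- pow x 3 + pow x 2 - x - 1# + s) * h) m
    + (- ((pow x 4 - two * pow x 3 - 1#) * t) + (1# - x) * h)
      * pow ((- pow x 3 + pow x 2 - x - 1# - s) * h) m
-- The excluded values of x are those with s = 0, already ruled out by 2st = 1.
proposition2p4 F m x s t h _ _ _ _ s² 2h≈1 2st≈1 =
  Satisfies-unique a-satisfies (closedForm-satisfies s² 2h≈1 2st≈1)
    (trans a₀ (sym (closedForm₀ s² 2h≈1 2st≈1))) (trans a₁ (sym (closedForm₁ s² 2h≈1 2st≈1))) m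
  where
  open Field F
  open LinearRecurrences commutativeRing
  open CharacteristicDeterminant commutativeRing x
  open ClosedForm commutativeRing x s t h
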